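{- Let $n$ and $k$ be positive integers with $n\ge k+\lceil n/3\rceil$. For the path graph $P_n$, $$Sb_k(P_n)=\begin{cases}\left\lfloor\frac{3k-1}{2}\right\rfloor, & n\equiv 0\pmod 3,\\[2pt] \left\lfloor\frac{3k+1}{2}\right\rfloor, & n\equiv 1\pmod 3,\\[2pt] \left\lceil\frac{3k-1}{2}\right\rceil, & n\equiv 2\pmod 3.\end{cases}$$
   Context: $\gamma(G)$ is the domination number of $G$ (minimum size of a dominating set); $\gamma(P_n)=\lceil n/3\rceil$. For a positive integer $k$, $Sb_k(G)$ is the minimum size of a set $\mathcal{E}$ of edges of $G$ such that $\gamma(G-\mathcal{E})=\gamma(G)+k$. -}

module Defs where

open import Data.Nat using (ℕ; zero; suc; _+_; _*_; _∸_; _≤_; _/_; _%_)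
open import Data.Fin using (Fin; inject₁) renaming (suc to fsuc)
open import Data.Fin.Subset using (Subset; _∈_; _∉_; ∣_∣)
open import Data.Product using (_×_; _,_; Σ; ∃)
open import Data.Sum using (_⊎_)
open import Relation.Binary.PropositionalEquality using (_≡_)

record Graph : Set where
  field
    nv   : ℕ
    ne   : ℕ
    ends : Fin ne → Fin nv × Fin nv
open Graph public

-- Adjacency in the spanning subgraph G - E (E a set of edges of G to delete).
Adj : (G : Graph) → Subset (ne G) → Fin (nv G) → Fin (nv G) → Set
Adj G E u v = Σ (Fin (ne G)) λ e → e ∉ E × (ends G e ≡ (u , v) ⊎ ends G e ≡ (v , u))

Dominating : (G : Graph) → Subset (ne G) → Subset (nv G) → Set
Dominating G E D = ∀ v → v ∈ D ⊎ Σ (Fin (nv G)) λ u → u ∈ D × Adj G E u v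

IsDomNum : (G : Graph) → Subset (ne G) → ℕ → Set
IsDomNum G E m =
  (Σ (Subset (nv G)) λ D → Dominating G E D × ∣ D ∣ ≡ m)
  × (∀ D → Dominating G E D → m ≤ ∣ D ∣)

RaisesBy : (G : Graph) → ℕ → Subset (ne G) → Set
RaisesBy G k E = ∃ λ g → IsDomNum G noEdges g × IsDomNum G E (g + k)
  where
  open import Data.Fin.Subset using (⊥)
  noEdges = ⊥

IsSb : Graph → ℕ → ℕ → Set
IsSb G k s =
  (Σ (Subset (ne G)) λ E → RaisesBy G k E × ∣ E ∣ ≡ s)
  × (∀ E → RaisesBy G k E → s ≤ ∣ E ∣)

Path : ℕ → Graph
Path zero    = record { nv = zero ; ne = zero ; ends = λ () }
Path (suc n) = record { nv = suc n ; ne = n ; ends = λ j → inject₁ j , fsuc j }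

ceil3 : ℕ → ℕ
ceil3 n = (n + 2) / 3

SbPathValue : ℕ → ℕ → ℕ
SbPathValue n k with n % 3
... | 0 = (3 * k ∸ 1) / 2          -- ⌊(3k-1)/2⌋  (k ≥ 1)
... | 1 = (3 * k + 1) / 2
... | _ = (3 * k) / 2              -- ⌈(3k-1)/2⌉ = ⌊3k/2⌋

-- Deleting a set E of edges splits P_n into ∣E∣ + 1 subpaths, and taking every third
-- vertex on each of them gives γ(P_n - E) ≤ (n + 2∣E∣ + 2)/3.  Deleting the first e edges
-- attains this up to rounding: the e isolated vertices must all be chosen, and the rest
-- is a path needing a third of its vertices, so 3γ ≥ n + 2e.  Hence Sb_k(P_n) is the least
-- s with 3(⌈n/3⌉ + k) ≤ n + 2s + 2, which is the claimed value in each residue class of n;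
-- the hypothesis n ≥ k + ⌈n/3⌉ makes this s smaller than the number of edges.
module Submission where

open import Defs
open import Data.Bool using (Bool; true; false; _∨_; _∧_; not; T)
open import Data.Empty using (⊥-elim)
open import Data.Fin using (Fin; inject₁) renaming (zero to fzero; suc to fsuc)
open import Data.Fin.Subset using (Subset; _∈_; _∉_; ∣_∣) renaming (⊥ to ∅)
open import Data.Nat using (ℕ; zero; suc; _+_; _*_; _∸_; _≤_; _<_; z≤n; s≤s)
open import Data.Nat.DivMod
open import Data.Nat.Divisibility using (divides-refl)
open import Data.Nat.Properties
open import Algebra.Properties.CommutativeSemigroup +-commutativeSemigroup using (xy∙z≈xz∙y)
open import Data.Nat.Tactic.RingSolver using (solve-∀)
open import Data.Product using (_×_; _,_; Σ; proj₁; proj₂)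
open import Data.Sum using (_⊎_; inj₁; inj₂)
open import Data.Unit using (tt)
open import Data.Vec using ([]; _∷_; head; here; there)
open import Function using (_∘_)
open import Relation.Binary.PropositionalEquality

Dominated : (G : Graph) → Subset (ne G) → Subset (nv G) → Fin (nv G) → Set
Dominated G E D v = v ∈ D ⊎ Σ (Fin (nv G)) λ u → u ∈ D × Adj G E u v

-- covered h E D v decides whether v is dominated by D in P_(m+1) - E, where h
-- says whether vertex 0 is also dominated by a vertex further to the left.
covered : ∀ {m} → Bool → Subset m → Subset (suc m) → Fin (suc m) → Bool
covered h []      (d ∷ []) fzero    = h ∨ d
covered h (c ∷ E) (d ∷ D)  fzero    = h ∨ d ∨ (not c ∧ head D)
covered h (c ∷ E) (d ∷ D)  (fsuc v) = covered (d ∧ not c) E D v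

∉-head : ∀ {m} {E : Subset m} {c} → fzero ∉ (c ∷ E) → c ≡ false
∉-head {c = false} _   = refl
∉-head {c = true}  0∉ = ⊥-elim (0∉ here)

∈⇒covered : ∀ {m} h (E : Subset m) D v → v ∈ D → T (covered h E D v)
∈⇒covered false []      (.true ∷ []) fzero    here      = tt
∈⇒covered true  []      (.true ∷ []) fzero    here      = tt
∈⇒covered false (c ∷ E) (.true ∷ D)  fzero    here      = tt
∈⇒covered true  (c ∷ E) (.true ∷ D)  fzero    here      = tt
∈⇒covered h     (c ∷ E) (d ∷ D)      (fsuc v) (there v∈D) = ∈⇒covered _ E D v v∈D

leftNeighbour⇒covered : ∀ {m} h (E : Subset m) D e →
  inject₁ e ∈ D → e ∉ E → T (covered h E D (fsuc e))
leftNeighbour⇒covered h (c ∷ E) (.true ∷ D) fzero here e∉E with ∉-head e∉E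
leftNeighbour⇒covered h (.false ∷ [])     (.true ∷ d ∷ []) fzero here _ | refl = tt
leftNeighbour⇒covered h (.false ∷ c ∷ E) (.true ∷ d ∷ D)  fzero here _ | refl = tt
leftNeighbour⇒covered h (c ∷ E) (d ∷ D) (fsuc e) (there e∈D) e∉E =
  leftNeighbour⇒covered _ E D e e∈D (λ e∈E → e∉E (there e∈E))

rightNeighbour⇒covered : ∀ {m} h (E : Subset m) D e →
  fsuc e ∈ D → e ∉ E → T (covered h E D (inject₁ e))
rightNeighbour⇒covered h (c ∷ E) (d ∷ .true ∷ D) fzero (there here) e∉E with ∉-head e∉E
rightNeighbour⇒covered false (.false ∷ E) (false ∷ .true ∷ D) fzero (there here) _ | refl = tt
rightNeighbour⇒covered false (.false ∷ E) (true  ∷ .true ∷ D) fzero (there here) _ | refl = tt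
rightNeighbour⇒covered true  (.false ∷ E) (d     ∷ .true ∷ D) fzero (there here) _ | refl = tt
rightNeighbour⇒covered h (c ∷ E) (d ∷ D) (fsuc e) (there e∈D) e∉E =
  rightNeighbour⇒covered _ E D e e∈D (λ e∈E → e∉E (there e∈E))

dominated⇒covered : ∀ {m} (E : Subset m) D v →
  Dominated (Path (suc m)) E D v → T (covered false E D v)
dominated⇒covered E D v (inj₁ v∈D)                                = ∈⇒covered false E D v v∈D
dominated⇒covered E D _ (inj₂ (_ , u∈D , e , e∉E , inj₁ refl)) = leftNeighbour⇒covered false E D e u∈D e∉E
dominated⇒covered E D _ (inj₂ (_ , u∈D , e , e∉E , inj₂ refl)) = rightNeighbour⇒covered false E D e u∈D e∉E

covered⇒dominated : ∀ {m} h (E : Subset m) D v → T (covered h E D v) →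
  (v ≡ fzero × T h) ⊎ Dominated (Path (suc m)) E D v
covered⇒dominated true  []      (d ∷ [])    fzero _ = inj₁ (refl , tt)
covered⇒dominated false []      (true ∷ []) fzero _ = inj₂ (inj₁ here)
covered⇒dominated true  (c ∷ E) (d ∷ D)     fzero _ = inj₁ (refl , tt)
covered⇒dominated false (c ∷ E) (true ∷ D)  fzero _ = inj₂ (inj₁ here)
covered⇒dominated false (false ∷ E) (false ∷ true ∷ D) fzero _ =
  inj₂ (inj₂ (fsuc fzero , there here , fzero , (λ ()) , inj₂ refl))
covered⇒dominated h (c ∷ E) (d ∷ D) (fsuc v) cov with covered⇒dominated (d ∧ not c) E D v cov
covered⇒dominated h (false ∷ E) (true ∷ D) (fsuc .fzero) _ | inj₁ (refl , _) =
  inj₂ (inj₂ (fzero , here , fzero , (λ ()) , inj₁ refl))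
covered⇒dominated h (true ∷ E) (true ∷ D) (fsuc .fzero) _ | inj₁ (refl , ())
covered⇒dominated h (c ∷ E) (false ∷ D) (fsuc .fzero) _ | inj₁ (refl , ())
... | inj₂ (inj₁ v∈D) = inj₂ (inj₁ (there v∈D))
... | inj₂ (inj₂ (u , u∈D , e , e∉E , inj₁ refl)) =
  inj₂ (inj₂ (fsuc u , there u∈D , fsuc e , (λ { (there e∈E) → e∉E e∈E }) , inj₁ refl))
... | inj₂ (inj₂ (u , u∈D , e , e∉E , inj₂ refl)) =
  inj₂ (inj₂ (fsuc u , there u∈D , fsuc e , (λ { (there e∈E) → e∉E e∈E }) , inj₂ refl))

dominating⇒covered : ∀ {m} (E : Subset m) D →
  Dominating (Path (suc m)) E D → ∀ v → T (covered false E D v)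
dominating⇒covered E D dom v = dominated⇒covered E D v (dom v)

covered⇒dominating : ∀ {m} (E : Subset m) D →
  (∀ v → T (covered false E D v)) → Dominating (Path (suc m)) E D
covered⇒dominating E D cov v with covered⇒dominated false E D v (cov v)
... | inj₂ dominated = dominated

greedy : ∀ {m} → Subset m → Subset (suc m)
greedy []                      = true ∷ []
greedy (true ∷ E)              = true ∷ greedy E
greedy (false ∷ [])            = true ∷ false ∷ []
greedy (false ∷ true ∷ E)      = true ∷ false ∷ greedy E
greedy (false ∷ false ∷ [])    = false ∷ true ∷ false ∷ []
greedy (false ∷ false ∷ c ∷ E) = false ∷ true ∷ false ∷ greedy E

greedy-covers : ∀ {m} (E : Subset m) v → T (covered false E (greedy E) v)
greedy-covers []                      fzero                      = tt
greedy-covers (true ∷ E)              fzero                      = tt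
greedy-covers (true ∷ E)              (fsuc v)                   = greedy-covers E v
greedy-covers (false ∷ [])            fzero                      = tt
greedy-covers (false ∷ [])            (fsuc fzero)               = tt
greedy-covers (false ∷ true ∷ E)      fzero                      = tt
greedy-covers (false ∷ true ∷ E)      (fsuc fzero)               = tt
greedy-covers (false ∷ true ∷ E)      (fsuc (fsuc v))            = greedy-covers E v
greedy-covers (false ∷ false ∷ [])    fzero                      = tt
greedy-covers (false ∷ false ∷ [])    (fsuc fzero)               = tt
greedy-covers (false ∷ false ∷ [])    (fsuc (fsuc fzero))        = tt
greedy-covers (false ∷ false ∷ c ∷ E) fzero                      = tt
greedy-covers (false ∷ false ∷ c ∷ E) (fsuc fzero)               = tt
greedy-covers (false ∷ false ∷ c ∷ E) (fsuc (fsuc fzero))        = tt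
greedy-covers (false ∷ false ∷ c ∷ E) (fsuc (fsuc (fsuc v)))     = greedy-covers E v

greedy-dominating : ∀ {m} (E : Subset m) → Dominating (Path (suc m)) E (greedy E)
greedy-dominating E = covered⇒dominating E (greedy E) (greedy-covers E)

∣∣-∷ : ∀ {m} c (E : Subset m) → ∣ E ∣ ≤ ∣ c ∷ E ∣
∣∣-∷ true  E = n≤1+n ∣ E ∣
∣∣-∷ false E = ≤-refl

greedy-size : ∀ {m} (E : Subset m) → ∣ greedy E ∣ * 3 ≤ 2 + (∣ E ∣ * 2 + suc m)
greedy-size []                   = ≤-refl
greedy-size (false ∷ [])         = s≤s (s≤s (s≤s z≤n))
greedy-size (false ∷ false ∷ []) = s≤s (s≤s (s≤s z≤n))
greedy-size {suc m} (true ∷ E) =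
  ≤-trans (+-monoʳ-≤ 3 (greedy-size E)) (≤-reflexive (shift ∣ E ∣ m))
  where
  shift : ∀ e m → 3 + (2 + (e * 2 + suc m)) ≡ 2 + (suc e * 2 + suc (suc m))
  shift = solve-∀
greedy-size {suc (suc m)} (false ∷ true ∷ E) = begin
  3 + ∣ greedy E ∣ * 3                          ≤⟨ +-monoʳ-≤ 3 (greedy-size E) ⟩
  3 + (2 + (∣ E ∣ * 2 + suc m))                 <⟨ n<1+n _ ⟩
  suc (3 + (2 + (∣ E ∣ * 2 + suc m)))           ≡⟨ shift ∣ E ∣ m ⟩
  2 + (suc ∣ E ∣ * 2 + suc (suc (suc m)))       ∎
  where
  open ≤-Reasoning
  shift : ∀ e m → suc (3 + (2 + (e * 2 + suc m))) ≡ 2 + (suc e * 2 + suc (suc (suc m)))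
  shift = solve-∀
greedy-size {suc (suc (suc m))} (false ∷ false ∷ c ∷ E) = begin
  3 + ∣ greedy E ∣ * 3                          ≤⟨ +-monoʳ-≤ 3 (greedy-size E) ⟩
  3 + (2 + (∣ E ∣ * 2 + suc m))                 ≡⟨ shift ∣ E ∣ m ⟩
  2 + (∣ E ∣ * 2 + suc (suc (suc (suc m))))     ≤⟨ +-monoʳ-≤ 2 (+-monoˡ-≤ _ (*-monoˡ-≤ 2 (∣∣-∷ c E))) ⟩
  2 + (∣ c ∷ E ∣ * 2 + suc (suc (suc (suc m)))) ∎
  where
  open ≤-Reasoning
  shift : ∀ e m → 3 + (2 + (e * 2 + suc m)) ≡ 2 + (e * 2 + suc (suc (suc (suc m))))
  shift = solve-∀

bit : Bool → ℕ
bit false = 0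
bit true  = 1

-- The head and h terms strengthen the statement ⌈(m+1)/3⌉ ≤ ∣ D ∣ enough for induction.
covered-∅-size : ∀ {m} h (D : Subset (suc m)) → (∀ v → T (covered h ∅ D v)) →
  bit (head D) + suc m ≤ bit h + ∣ D ∣ * 3
covered-∅-size {zero}  false (true ∷ [])  _   = s≤s (s≤s z≤n)
covered-∅-size {zero}  true  (true ∷ [])  _   = s≤s (s≤s z≤n)
covered-∅-size {zero}  true  (false ∷ []) _   = s≤s z≤n
covered-∅-size {zero}  false (false ∷ []) cov = ⊥-elim (cov fzero)
covered-∅-size {suc m} h (true ∷ D) cov =
  ≤-trans (s≤s (s≤s (m+n≤o⇒n≤o (bit (head D)) (covered-∅-size true D (cov ∘ fsuc)))))
          (m≤n+m _ (bit h))
covered-∅-size {suc m} true  (false ∷ D)         cov =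
  s≤s (m+n≤o⇒n≤o (bit (head D)) (covered-∅-size false D (cov ∘ fsuc)))
covered-∅-size {suc m} false (false ∷ true ∷ D)  cov = covered-∅-size false (true ∷ D) (cov ∘ fsuc)
covered-∅-size {suc m} false (false ∷ false ∷ D) cov = ⊥-elim (cov fzero)

-- Deleting the first e edges of P_(m+1) isolates the vertices 0, …, e-1.
initialEdges : ℕ → (m : ℕ) → Subset m
initialEdges zero    m       = ∅
initialEdges (suc e) zero    = []
initialEdges (suc e) (suc m) = true ∷ initialEdges e m

∣initialEdges∣ : ∀ {e m} → e ≤ m → ∣ initialEdges e m ∣ ≡ e
∣initialEdges∣ {zero}  {zero}  _       = refl
∣initialEdges∣ {zero}  {suc m} _       = ∣initialEdges∣ {zero} {m} z≤n
∣initialEdges∣ {suc e} {suc m} (s≤s e≤m) = cong suc (∣initialEdges∣ e≤m)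

covered-initialEdges-size : ∀ e {m} (D : Subset (suc m)) → e ≤ m →
  (∀ v → T (covered false (initialEdges e m) D v)) → e * 2 + suc m ≤ ∣ D ∣ * 3
covered-initialEdges-size zero D _ cov = m+n≤o⇒n≤o (bit (head D)) (covered-∅-size false D cov)
covered-initialEdges-size (suc e) {suc m} (true ∷ D) (s≤s e≤m) cov =
  subst (_≤ 3 + ∣ D ∣ * 3) (cong (2 +_) (sym (+-suc (e * 2) (suc m))))
    (+-monoʳ-≤ 3 (covered-initialEdges-size e D e≤m (cov ∘ fsuc)))
covered-initialEdges-size (suc e) {suc m} (false ∷ D) _ cov = ⊥-elim (cov fzero)

*-cancelʳ-≤-slack : ∀ d x y a → x * suc d ≤ d + a → a ≤ y * suc d → x ≤ y
*-cancelʳ-≤-slack d x y a x≤d+a a≤y = ≤-pred (*-cancelʳ-< (suc d) x (suc y) (begin-strict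
  x * suc d        ≤⟨ x≤d+a ⟩
  d + a            ≤⟨ +-monoʳ-≤ d a≤y ⟩
  d + y * suc d    <⟨ n<1+n _ ⟩
  suc y * suc d    ∎))
  where open ≤-Reasoning

isDomNum : ∀ G E D {g} → Dominating G E D → ∣ D ∣ ≤ g →
  (∀ D′ → Dominating G E D′ → g ≤ ∣ D′ ∣) → IsDomNum G E g
isDomNum G E D dom ∣D∣≤g minimal = (D , dom , ≤-antisym ∣D∣≤g (minimal D dom)) , minimal

domNum-initialEdges : ∀ {e m g} → e ≤ m →
  g * 3 ≤ 2 + (e * 2 + suc m) → e * 2 + suc m ≤ g * 3 →
  IsDomNum (Path (suc m)) (initialEdges e m) g
domNum-initialEdges {e} {m} {g} e≤m upper lower =
  isDomNum (Path (suc m)) E (greedy E) (greedy-dominating E)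
    (*-cancelʳ-≤-slack 2 _ g _ greedy-bound lower)
    (λ D dom → *-cancelʳ-≤-slack 2 g _ _ upper
      (covered-initialEdges-size e D e≤m (dominating⇒covered E D dom)))
  where
  E = initialEdges e m
  greedy-bound : ∣ greedy E ∣ * 3 ≤ 2 + (e * 2 + suc m)
  greedy-bound = subst (λ x → ∣ greedy E ∣ * 3 ≤ 2 + (x * 2 + suc m))
    (∣initialEdges∣ e≤m) (greedy-size E)

ceil3-upper : ∀ n → ceil3 n * 3 ≤ 2 + n
ceil3-upper n = subst (ceil3 n * 3 ≤_) (+-comm n 2) (m/n*n≤m (n + 2) 3)

ceil3-lower : ∀ n → n ≤ ceil3 n * 3
ceil3-lower n = +-cancelʳ-≤ 2 n (ceil3 n * 3) (begin
  n + 2                                ≡⟨ m≡m%n+[m/n]*n (n + 2) 3 ⟩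
  (n + 2) % 3 + ceil3 n * 3            ≤⟨ +-monoˡ-≤ _ (≤-pred (m%n<n (n + 2) 3)) ⟩
  2 + ceil3 n * 3                      ≡⟨ +-comm 2 _ ⟩
  ceil3 n * 3 + 2                      ∎)
  where open ≤-Reasoning

ceil3-mod : ∀ n → ceil3 n ≡ n / 3 + ceil3 (n % 3)
ceil3-mod n = begin
  (n + 2) / 3                          ≡⟨ cong (λ x → (x + 2) / 3) (m≡m%n+[m/n]*n n 3) ⟩
  (n % 3 + n / 3 * 3 + 2) / 3          ≡⟨ cong (_/ 3) (xy∙z≈xz∙y (n % 3) (n / 3 * 3) 2) ⟩
  (n % 3 + 2 + n / 3 * 3) / 3          ≡⟨ +-distrib-/-∣ʳ (n % 3 + 2) (divides-refl (n / 3)) ⟩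
  ceil3 (n % 3) + n / 3 * 3 / 3        ≡⟨ cong (ceil3 (n % 3) +_) (m*n/n≡m (n / 3) 3) ⟩
  ceil3 (n % 3) + n / 3                ≡⟨ +-comm (ceil3 (n % 3)) (n / 3) ⟩
  n / 3 + ceil3 (n % 3)                ∎
  where open ≡-Reasoning

halving-bounds : ∀ N a b → b ≡ suc (N + a) →
  N / 2 * 2 + a < b × b ≤ 2 + (N / 2 * 2 + a)
halving-bounds N a _ refl =
  s≤s (+-monoˡ-≤ a (m/n*n≤m N 2)) , s≤s (+-monoˡ-≤ a N≤1+2[N/2])
  where
  N≤1+2[N/2] : N ≤ suc (N / 2 * 2)
  N≤1+2[N/2] = begin
    N                     ≡⟨ m≡m%n+[m/n]*n N 2 ⟩
    N % 2 + N / 2 * 2     ≤⟨ +-monoˡ-≤ _ (≤-pred (m%n<n N 2)) ⟩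
    suc (N / 2 * 2)       ∎
    where open ≤-Reasoning

-- In each residue class of n, 3 (⌈n/3⌉ + k) = N + n + 1 where SbPathValue n k = ⌊N/2⌋.
sbValue-bounds : ∀ n k → 1 ≤ k →
  SbPathValue n k * 2 + n < (ceil3 n + k) * 3 × (ceil3 n + k) * 3 ≤ 2 + (SbPathValue n k * 2 + n)
sbValue-bounds n (suc j) _ with n % 3 | n / 3 | m≡m%n+[m/n]*n n 3 | ceil3-mod n | m%n<n n 3
... | 0 | q | refl | ceil3≡ | _ =
  halving-bounds (3 * suc j ∸ 1) (q * 3) _ (trans (cong (λ c → (c + suc j) * 3) ceil3≡) (identity q j))
  where
  identity : ∀ q j → (q + 0 + suc j) * 3 ≡ suc (j + (suc j + (suc j + 0)) + q * 3)
  identity = solve-∀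
... | 1 | q | refl | ceil3≡ | _ =
  halving-bounds (3 * suc j + 1) (1 + q * 3) _ (trans (cong (λ c → (c + suc j) * 3) ceil3≡) (identity q j))
  where
  identity : ∀ q j → (q + 1 + suc j) * 3 ≡ suc (3 * suc j + 1 + suc (q * 3))
  identity = solve-∀
... | 2 | q | refl | ceil3≡ | _ =
  halving-bounds (3 * suc j) (2 + q * 3) _ (trans (cong (λ c → (c + suc j) * 3) ceil3≡) (identity q j))
  where
  identity : ∀ q j → (q + 1 + suc j) * 3 ≡ suc (3 * suc j + suc (suc (q * 3)))
  identity = solve-∀
... | suc (suc (suc _)) | _ | _ | _ | s≤s (s≤s (s≤s ()))

sbValue<n : ∀ n k → 1 ≤ k → k + ceil3 n ≤ n → SbPathValue n k < n
sbValue<n n k 1≤k k+c≤n = *-cancelʳ-< 2 _ n (+-cancelʳ-< n _ _ (begin-strict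
  SbPathValue n k * 2 + n   <⟨ proj₁ (sbValue-bounds n k 1≤k) ⟩
  (ceil3 n + k) * 3         ≤⟨ *-monoˡ-≤ 3 (subst (_≤ n) (+-comm k (ceil3 n)) k+c≤n) ⟩
  n * 3                     ≡⟨ trans (*-suc n 2) (+-comm n (n * 2)) ⟩
  n * 2 + n                 ∎))
  where open ≤-Reasoning

sbValue-minimal : ∀ n k x → 1 ≤ k → (ceil3 n + k) * 3 ≤ 2 + (x * 2 + n) → SbPathValue n k ≤ x
sbValue-minimal n k x 1≤k bound =
  *-cancelʳ-≤-slack 1 _ x (x * 2) (+-cancelʳ-≤ n _ _ (≤-pred (begin-strict
    SbPathValue n k * 2 + n   <⟨ proj₁ (sbValue-bounds n k 1≤k) ⟩
    (ceil3 n + k) * 3         ≤⟨ bound ⟩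
    2 + (x * 2 + n)           ∎))) ≤-refl
  where open ≤-Reasoning

isDomNum-unique : ∀ {G E a b} → IsDomNum G E a → IsDomNum G E b → a ≡ b
isDomNum-unique ((D , dom , refl) , a-minimal) ((D′ , dom′ , refl) , b-minimal) =
  ≤-antisym (a-minimal D′ dom′) (b-minimal D dom)

theorem7 : (n k : ℕ) → 1 ≤ n → 1 ≤ k → k + ceil3 n ≤ n →
    IsSb (Path n) k (SbPathValue n k)
theorem7 n@(suc m) k _ 1≤k k+c≤n =
  (initialEdges s m , (c , γ , γ-raised) , ∣initialEdges∣ s≤m) , minimal
  where
  c = ceil3 n
  s = SbPathValue n k
  s≤m : s ≤ m
  s≤m = ≤-pred (sbValue<n n k 1≤k k+c≤n)
  γ : IsDomNum (Path n) ∅ c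
  γ = domNum-initialEdges z≤n (ceil3-upper n) (ceil3-lower n)
  γ-raised : IsDomNum (Path n) (initialEdges s m) (c + k)
  γ-raised = domNum-initialEdges s≤m (proj₂ (sbValue-bounds n k 1≤k))
                                     (<⇒≤ (proj₁ (sbValue-bounds n k 1≤k)))
  minimal : ∀ E → RaisesBy (Path n) k E → s ≤ ∣ E ∣
  minimal E (g , γ′ , (_ , g+k-minimal)) = sbValue-minimal n k ∣ E ∣ 1≤k (begin
    (c + k) * 3           ≡⟨ cong (λ x → (x + k) * 3) (isDomNum-unique γ γ′) ⟩
    (g + k) * 3           ≤⟨ *-monoˡ-≤ 3 (g+k-minimal (greedy E) (greedy-dominating E)) ⟩
    ∣ greedy E ∣ * 3      ≤⟨ greedy-size E ⟩
    2 + (∣ E ∣ * 2 + n)   ∎)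
    where open ≤-Reasoning
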